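{- Let $f\in\mathcal{G}_1$ be $n$-ary, given by $f=2x_1\cdots x_n\left(\sum_{i=1}^n a_ix_i^2+\sum_{i=1}^n b_ix_i+c\right)$ with $a_i,b_i\in\{0,1\}$, $c\in\{0,1,2,3\}$, and assume $a_i\neq 0$ for some $i$. If $f\in\mathcal{G}_0$, then $C(f)=C(2w_n)$. If $f\in\mathcal{G}_1\setminus\mathcal{G}_0$, then $C(f)=C(2q_n)$.
   Context: Arithmetic is in $\mathbb{Z}_8$. $\mathcal{G}_1$ is the set of all operations (of any arity $n\ge1$) given by polynomials $2x_1\cdots x_n(\sum_{i=1}^n a_ix_i^2+\sum_{i=1}^n b_ix_i+c)$ with $a_i,b_i\in\{0,1\}$ and $c\in\{0,1,2,3\}$; $\mathcal{G}_0\subseteq\mathcal{G}_1$ consists of those for which $\sum_i a_i+\sum_i b_i+c$ is even. For an operation $g$, $C(g)$ denotes the clone on $\mathbb{Z}_8$ generated by $g$, the binary addition and all unary constant operations. $w_n=x_1\cdots x_n(x_1^2+1)$ and $q_n=x_1^3x_2\cdots x_n$. -}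

module Defs where

open import Data.Nat using (ℕ; zero; suc; _+_; _*_)
open import Data.Nat.DivMod using (_mod_)
open import Data.Nat.Divisibility using (_∣_)
open import Data.Fin using (Fin; toℕ) renaming (zero to fzero; suc to fsuc)
open import Data.Product using (Σ; ∃; _×_; _,_)
open import Relation.Binary.PropositionalEquality using (_≡_)

ℤ₈ : Set
ℤ₈ = Fin 8

[_]₈ : ℕ → ℤ₈
[ k ]₈ = k mod 8

_⊕_ : ℤ₈ → ℤ₈ → ℤ₈
x ⊕ y = [ toℕ x + toℕ y ]₈

sumF : ∀ {n} → (Fin n → ℕ) → ℕ
sumF {zero} f = 0
sumF {suc n} f = f fzero + sumF (λ i → f (fsuc i))

prodF : ∀ {n} → (Fin n → ℕ) → ℕ
prodF {zero} f = 1
prodF {suc n} f = f fzero * prodF (λ i → f (fsuc i))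

Op : ℕ → Set
Op m = (Fin m → ℤ₈) → ℤ₈

data Term (n : ℕ) (m : ℕ) : Set where
  var  : Fin m → Term n m
  cst  : ℤ₈ → Term n m
  add  : Term n m → Term n m → Term n m
  app  : (Fin n → Term n m) → Term n m

⟦_⟧ : ∀ {n m} → Term n m → Op n → Op m
⟦ var i ⟧   g x = x i
⟦ cst c ⟧   g x = c
⟦ add s t ⟧ g x = ⟦ s ⟧ g x ⊕ ⟦ t ⟧ g x
⟦ app ts ⟧  g x = g (λ j → ⟦ ts j ⟧ g x)

-- h belongs to C(g), the clone generated by g, + and the unary constants:
-- h is (pointwise) a term operation of that algebra.
_∈C_ : ∀ {n m} → Op m → Op n → Set
h ∈C g = ∃ λ t → ∀ x → ⟦ t ⟧ g x ≡ h x

_≡C_ : ∀ {n n'} → Op n → Op n' → Set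
g ≡C g' = ∀ m (h : Op m) → ((h ∈C g → h ∈C g') × (h ∈C g' → h ∈C g))

fOp : ∀ {n} → (Fin n → Fin 2) → (Fin n → Fin 2) → Fin 4 → Op n
fOp a b c x =
  [ 2 * prodF (λ i → toℕ (x i))
      * (sumF (λ i → toℕ (a i) * toℕ (x i) * toℕ (x i))
         + sumF (λ i → toℕ (b i) * toℕ (x i))
         + toℕ c) ]₈

InG₀ : ∀ {n} → (Fin n → Fin 2) → (Fin n → Fin 2) → Fin 4 → Set
InG₀ a b c = 2 ∣ (sumF (λ i → toℕ (a i)) + sumF (λ i → toℕ (b i)) + toℕ c)

twoW : ∀ m → Op (suc m)
twoW m x = [ 2 * prodF (λ i → toℕ (x i)) * (toℕ (x fzero) * toℕ (x fzero) + 1) ]₈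

twoQ : ∀ m → Op (suc m)
twoQ m x = [ 2 * toℕ (x fzero) * toℕ (x fzero) * prodF (λ i → toℕ (x i)) ]₈

{-# OPTIONS --safe #-}
-- Moving a variable with aₖ = 1 to the front writes f as 2x₀p(x₀² + βx₀ + r), where p is the product of
-- the other variables and r does not involve x₀; 2wₙ and 2qₙ have the same shape. The differences
-- Δφ(y, z) = φ(y + z) − φ(y) − φ(z) in x₀ of any such operation φ yield 4Π, 2Π(x₀ + 1) and 2Π(x₀² + 1) = 2wₙ,
-- where Π is the product of all variables, and by the symmetry of Π the same atoms for every variable. Conversely
-- f = Σ aᵢ 2Π(xᵢ² + 1) + Σ bᵢ 2Π(xᵢ + 1) + κ 2Π with κ = c − Σ aᵢ − Σ bᵢ. For f ∈ G₀, κ is even, so κ 2Π is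
-- a multiple of 4Π and C(f) = C(2wₙ). Otherwise κ is odd, κ² = 1 in ℤ₈ recovers 2Π from f, and
-- 2qₙ = 2wₙ − 2Π gives C(f) = C(2qₙ).
module Submission where

import Algebra.Properties.CommutativeMonoid.Sum as CommutativeMonoidSum
open import Data.Fin using (Fin; zero; suc; toℕ)
open import Data.Fin.Permutation using (Permutation′; _⟨$⟩ʳ_; _⟨$⟩ˡ_; inverseˡ; transpose)
open import Data.Fin.Properties using (toℕ-injective; toℕ-fromℕ<; fromℕ<-cong; toℕ<n; all?; _≟_)
open import Data.Nat using (ℕ; zero; suc; _+_; _*_; _%_)
open import Data.Nat.DivMod using (%-distribˡ-+; %-distribˡ-*; m<n⇒m%n≡m; [m+kn]%n≡m%n; m∣n⇒o%n%m≡o%m)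
open import Data.Nat.Divisibility
  using (_∣_; _∣?_; divides; m∣m*n; ∣m∣n⇒∣m+n; ∣m+n∣m⇒∣n; m%n≡0⇒n∣m; n∣m⇒m%n≡0)
open import Data.Nat.Properties
  using (+-0-commutativeMonoid; *-1-commutativeMonoid; *-comm; *-assoc; *-identityˡ; *-zeroʳ; +-identityʳ)
open import Data.Nat.Tactic.RingSolver using (solve-∀)
open import Data.Product using (∃; _×_; _,_; proj₁; proj₂)
open import Data.Sum using (_⊎_; inj₁; inj₂)
open import Data.Vec.Functional using (_∷_; tail)
open import Function using (_∘_)
open import Relation.Binary.PropositionalEquality
  using (_≡_; _≗_; refl; sym; trans; cong; cong₂; subst; module ≡-Reasoning)
open import Relation.Nullary using (¬_; contradiction)
open import Relation.Nullary.Decidable using (toWitness; _⊎-dec_)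

open import Defs renaming (_⊕_ to infixl 6 _⊕_)

open ≡-Reasoning

infixl 7 _⊗_
_⊗_ : ℤ₈ → ℤ₈ → ℤ₈
u ⊗ v = [ toℕ u * toℕ v ]₈

infixr 8 _·_
_·_ : ℕ → ℤ₈ → ℤ₈
zero  · u = [ 0 ]₈
suc k · u = u ⊕ k · u

infixl 6 _⊝_
_⊝_ : ℤ₈ → ℤ₈ → ℤ₈
u ⊝ v = u ⊕ 7 · v

toℕ-[]₈ : ∀ n → toℕ [ n ]₈ ≡ n % 8
toℕ-[]₈ n = toℕ-fromℕ< _

[]₈-cong : ∀ m n → m % 8 ≡ n % 8 → [ m ]₈ ≡ [ n ]₈
[]₈-cong m n e = fromℕ<-cong (m % 8) (n % 8) e _ _

[toℕ]₈ : ∀ u → [ toℕ u ]₈ ≡ u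
[toℕ]₈ u = toℕ-injective (trans (toℕ-[]₈ (toℕ u)) (m<n⇒m%n≡m (toℕ<n u)))

[m+n]₈≡[m]₈⊕[n]₈ : ∀ m n → [ m + n ]₈ ≡ [ m ]₈ ⊕ [ n ]₈
[m+n]₈≡[m]₈⊕[n]₈ m n = []₈-cong (m + n) (toℕ [ m ]₈ + toℕ [ n ]₈) (begin
  (m + n) % 8                    ≡⟨ %-distribˡ-+ m n 8 ⟩
  (m % 8 + n % 8) % 8            ≡⟨ cong₂ (λ u v → (u + v) % 8) (toℕ-[]₈ m) (toℕ-[]₈ n) ⟨
  (toℕ [ m ]₈ + toℕ [ n ]₈) % 8  ∎)

[m*n]₈≡[m]₈⊗[n]₈ : ∀ m n → [ m * n ]₈ ≡ [ m ]₈ ⊗ [ n ]₈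
[m*n]₈≡[m]₈⊗[n]₈ m n = []₈-cong (m * n) (toℕ [ m ]₈ * toℕ [ n ]₈) (begin
  (m * n) % 8                    ≡⟨ %-distribˡ-* m n 8 ⟩
  (m % 8 * (n % 8)) % 8          ≡⟨ cong₂ (λ u v → (u * v) % 8) (toℕ-[]₈ m) (toℕ-[]₈ n) ⟨
  (toℕ [ m ]₈ * toℕ [ n ]₈) % 8  ∎)

[k*n]₈≡k·[n]₈ : ∀ k n → [ k * n ]₈ ≡ k · [ n ]₈
[k*n]₈≡k·[n]₈ zero    n = refl
[k*n]₈≡k·[n]₈ (suc k) n = trans ([m+n]₈≡[m]₈⊕[n]₈ n (k * n)) (cong ([ n ]₈ ⊕_) ([k*n]₈≡k·[n]₈ k n))

[m+8k]₈≡[m]₈ : ∀ m k → [ m + 8 * k ]₈ ≡ [ m ]₈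
[m+8k]₈≡[m]₈ m k = []₈-cong (m + 8 * k) m (trans (cong (λ j → (m + j) % 8) (*-comm 8 k)) ([m+kn]%n≡m%n m k 8))

[m]₈⊝[n]₈ : ∀ m n → [ m ]₈ ⊝ [ n ]₈ ≡ [ m + 7 * n ]₈
[m]₈⊝[n]₈ m n = sym (trans ([m+n]₈≡[m]₈⊕[n]₈ m (7 * n)) (cong ([ m ]₈ ⊕_) ([k*n]₈≡k·[n]₈ 7 n)))

Σ₈ : ∀ {j} → (Fin j → ℤ₈) → ℤ₈
Σ₈ {zero}  u = [ 0 ]₈
Σ₈ {suc j} u = u zero ⊕ Σ₈ (tail u)

[Σk*n]₈≡Σk·[n]₈ : ∀ {j} (k n : Fin j → ℕ) → [ sumF (λ i → k i * n i) ]₈ ≡ Σ₈ (λ i → k i · [ n i ]₈)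
[Σk*n]₈≡Σk·[n]₈ {zero}  k n = refl
[Σk*n]₈≡Σk·[n]₈ {suc j} k n = trans ([m+n]₈≡[m]₈⊕[n]₈ (k zero * n zero) (sumF (λ i → k (suc i) * n (suc i))))
  (cong₂ _⊕_ ([k*n]₈≡k·[n]₈ (k zero) (n zero)) ([Σk*n]₈≡Σk·[n]₈ (tail k) (tail n)))

2∣[n]₈⇒2∣n : ∀ n → 2 ∣ toℕ [ n ]₈ → 2 ∣ n
2∣[n]₈⇒2∣n n 2∣[n]₈ = m%n≡0⇒n∣m n 2 (begin
  n % 2              ≡⟨ m∣n⇒o%n%m≡o%m 2 8 n (divides 4 refl) ⟨
  n % 8 % 2          ≡⟨ cong (_% 2) (toℕ-[]₈ n) ⟨
  toℕ [ n ]₈ % 2     ≡⟨ n∣m⇒m%n≡0 _ 2 2∣[n]₈ ⟩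
  0                  ∎)

even-or-square-one : ∀ u → 2 ∣ toℕ u ⊎ u ⊗ u ≡ [ 1 ]₈
even-or-square-one = toWitness {a? = all? λ u → (2 ∣? toℕ u) ⊎-dec (u ⊗ u ≟ [ 1 ]₈)} _

odd-square : ∀ {k} → ¬ 2 ∣ k → [ k * k ]₈ ≡ [ 1 ]₈
odd-square {k} k-odd with even-or-square-one [ k ]₈
... | inj₁ 2∣[k]₈   = contradiction (2∣[n]₈⇒2∣n k 2∣[k]₈) k-odd
... | inj₂ [k]₈²≡1 = trans ([m*n]₈≡[m]₈⊗[n]₈ k k) [k]₈²≡1

module ℕ-Σ = CommutativeMonoidSum +-0-commutativeMonoid
module ℕ-Π = CommutativeMonoidSum *-1-commutativeMonoid

sumF≡sum : ∀ {k} (f : Fin k → ℕ) → sumF f ≡ ℕ-Σ.sum f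
sumF≡sum {zero}  f = refl
sumF≡sum {suc k} f = cong (f zero +_) (sumF≡sum (tail f))

prodF≡product : ∀ {k} (f : Fin k → ℕ) → prodF f ≡ ℕ-Π.sum f
prodF≡product {zero}  f = refl
prodF≡product {suc k} f = cong (f zero *_) (prodF≡product (tail f))

sumF-cong : ∀ {k} {f g : Fin k → ℕ} → f ≗ g → sumF f ≡ sumF g
sumF-cong {f = f} {g} f≗g = trans (sumF≡sum f) (trans (ℕ-Σ.sum-cong-≗ f≗g) (sym (sumF≡sum g)))

prodF-cong : ∀ {k} {f g : Fin k → ℕ} → f ≗ g → prodF f ≡ prodF g
prodF-cong {f = f} {g} f≗g = trans (prodF≡product f) (trans (ℕ-Π.sum-cong-≗ f≗g) (sym (prodF≡product g)))

sumF-permute : ∀ {k} (f : Fin k → ℕ) (π : Permutation′ k) → sumF (f ∘ (π ⟨$⟩ʳ_)) ≡ sumF f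
sumF-permute f π = trans (sumF≡sum (f ∘ (π ⟨$⟩ʳ_))) (trans (sym (ℕ-Σ.sum-permute f π)) (sym (sumF≡sum f)))

prodF-permute : ∀ {k} (f : Fin k → ℕ) (π : Permutation′ k) → prodF (f ∘ (π ⟨$⟩ʳ_)) ≡ prodF f
prodF-permute f π = trans (prodF≡product (f ∘ (π ⟨$⟩ʳ_))) (trans (sym (ℕ-Π.sum-permute f π)) (sym (prodF≡product f)))

sumF-*[+1] : ∀ {k} (α u : Fin k → ℕ) C →
             sumF (λ i → α i * (C * (u i + 1))) ≡ C * (sumF (λ i → α i * u i) + sumF α)
sumF-*[+1] {zero}  α u C = sym (*-zeroʳ C)
sumF-*[+1] {suc k} α u C = begin
  α zero * (C * (u zero + 1)) + sumF (λ i → α (suc i) * (C * (u (suc i) + 1)))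
    ≡⟨ cong (α zero * (C * (u zero + 1)) +_) (sumF-*[+1] (tail α) (tail u) C) ⟩
  α zero * (C * (u zero + 1)) + C * (sumF (λ i → α (suc i) * u (suc i)) + sumF (tail α))
    ≡⟨ regroup (α zero) (u zero) C (sumF (λ i → α (suc i) * u (suc i))) (sumF (tail α)) ⟩
  C * ((α zero * u zero + sumF (λ i → α (suc i) * u (suc i))) + (α zero + sumF (tail α))) ∎
  where
  regroup : ∀ a v C S T → a * (C * (v + 1)) + C * (S + T) ≡ C * ((a * v + S) + (a + T))
  regroup = solve-∀

-- Clones

Extensional : ∀ {k} → Op k → Set
Extensional h = ∀ {x y} → x ≗ y → h x ≡ h y

infixl 9 _∘ₜ_
_∘ₜ_ : ∀ {n k l} → Term n l → (Fin l → Term n k) → Term n k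
var i   ∘ₜ σ = σ i
cst c   ∘ₜ σ = cst c
add s t ∘ₜ σ = add (s ∘ₜ σ) (t ∘ₜ σ)
app ts  ∘ₜ σ = app (λ j → ts j ∘ₜ σ)

module _ {n} {g : Op n} where

  ∈C-refl : g ∈C g
  ∈C-refl = app var , λ _ → refl

  ∈C-var : ∀ {k} (i : Fin k) → (λ x → x i) ∈C g
  ∈C-var i = var i , λ _ → refl

  ∈C-const : ∀ {k} (c : ℤ₈) → (λ (_ : Fin k → ℤ₈) → c) ∈C g
  ∈C-const c = cst c , λ _ → refl

  ∈C-resp : ∀ {k} {h h′ : Op k} → h ≗ h′ → h ∈C g → h′ ∈C g
  ∈C-resp h≗h′ (t , t≗h) = t , λ x → trans (t≗h x) (h≗h′ x)

  ∈C-⊕ : ∀ {k} {h₁ h₂ : Op k} → h₁ ∈C g → h₂ ∈C g → (λ x → h₁ x ⊕ h₂ x) ∈C g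
  ∈C-⊕ (s , s≗h₁) (t , t≗h₂) = add s t , λ x → cong₂ _⊕_ (s≗h₁ x) (t≗h₂ x)

  ∈C-· : ∀ {k} {h : Op k} j → h ∈C g → (λ x → j · h x) ∈C g
  ∈C-· zero    h∈g = ∈C-const [ 0 ]₈
  ∈C-· (suc j) h∈g = ∈C-⊕ h∈g (∈C-· j h∈g)

  ∈C-⊝ : ∀ {k} {h₁ h₂ : Op k} → h₁ ∈C g → h₂ ∈C g → (λ x → h₁ x ⊝ h₂ x) ∈C g
  ∈C-⊝ h₁∈g h₂∈g = ∈C-⊕ h₁∈g (∈C-· 7 h₂∈g)

  ∈C-Σ₈ : ∀ {k j} {hs : Fin j → Op k} → (∀ i → hs i ∈C g) → (λ x → Σ₈ (λ i → hs i x)) ∈C g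
  ∈C-Σ₈ {j = zero}  hs∈g = ∈C-const [ 0 ]₈
  ∈C-Σ₈ {j = suc j} hs∈g = ∈C-⊕ (hs∈g zero) (∈C-Σ₈ (hs∈g ∘ suc))

module _ {n} {g : Op n} (g-ext : Extensional g) where

  ⟦⟧-ext : ∀ {k} (t : Term n k) → Extensional (⟦ t ⟧ g)
  ⟦⟧-ext (var i)   x≗y = x≗y i
  ⟦⟧-ext (cst c)   x≗y = refl
  ⟦⟧-ext (add s t) x≗y = cong₂ _⊕_ (⟦⟧-ext s x≗y) (⟦⟧-ext t x≗y)
  ⟦⟧-ext (app ts)  x≗y = g-ext (λ j → ⟦⟧-ext (ts j) x≗y)

  ⟦∘ₜ⟧ : ∀ {k l} (t : Term n l) (σ : Fin l → Term n k) x → ⟦ t ∘ₜ σ ⟧ g x ≡ ⟦ t ⟧ g (λ j → ⟦ σ j ⟧ g x)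
  ⟦∘ₜ⟧ (var i)   σ x = refl
  ⟦∘ₜ⟧ (cst c)   σ x = refl
  ⟦∘ₜ⟧ (add s t) σ x = cong₂ _⊕_ (⟦∘ₜ⟧ s σ x) (⟦∘ₜ⟧ t σ x)
  ⟦∘ₜ⟧ (app ts)  σ x = g-ext (λ j → ⟦∘ₜ⟧ (ts j) σ x)

  ∈C-app : ∀ {k l} {G : Op l} {hs : Fin l → Op k} →
           G ∈C g → (∀ j → hs j ∈C g) → (λ x → G (λ j → hs j x)) ∈C g
  ∈C-app {k} {l} {G} {hs} (t , t≗G) hs∈g = t ∘ₜ σ , λ x → begin
    ⟦ t ∘ₜ σ ⟧ g x                ≡⟨ ⟦∘ₜ⟧ t σ x ⟩
    ⟦ t ⟧ g (λ j → ⟦ σ j ⟧ g x)   ≡⟨ ⟦⟧-ext t (λ j → proj₂ (hs∈g j) x) ⟩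
    ⟦ t ⟧ g (λ j → hs j x)        ≡⟨ t≗G _ ⟩
    G (λ j → hs j x)              ∎
    where
    σ : Fin l → Term n k
    σ j = proj₁ (hs∈g j)

  ∈C-rename : ∀ {k l} {h : Op l} (ρ : Fin l → Fin k) → h ∈C g → (λ x → h (x ∘ ρ)) ∈C g
  ∈C-rename ρ h∈g = ∈C-app h∈g (λ j → ∈C-var (ρ j))

  ∈C-trans : ∀ {l k} {G : Op l} {h : Op k} → G ∈C g → h ∈C G → h ∈C g
  ∈C-trans {G = G} G∈g (t , t≗h) = ∈C-resp t≗h (⟦⟧∈C t)
    where
    ⟦⟧∈C : ∀ {k} (t : Term _ k) → ⟦ t ⟧ G ∈C g
    ⟦⟧∈C (var i)   = ∈C-var i
    ⟦⟧∈C (cst c)   = ∈C-const c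
    ⟦⟧∈C (add s t) = ∈C-⊕ (⟦⟧∈C s) (⟦⟧∈C t)
    ⟦⟧∈C (app ts)  = ∈C-app G∈g (λ j → ⟦⟧∈C (ts j))

mutually-∈C⇒≡C : ∀ {n n′} {g : Op n} {g′ : Op n′} →
                 Extensional g → Extensional g′ → g ∈C g′ → g′ ∈C g → g ≡C g′
mutually-∈C⇒≡C g-ext g′-ext g∈g′ g′∈g _ _ = ∈C-trans g′-ext g∈g′ , ∈C-trans g-ext g′∈g

-- Operations 2x₀p(x₀² + βx₀ + r) and the atoms they generate

Π : ∀ {k} → (Fin k → ℤ₈) → ℕ
Π x = prodF (λ i → toℕ (x i))

Π₈ : ∀ {k} → (Fin k → ℤ₈) → ℤ₈
Π₈ x = [ Π x ]₈

Π-cong : ∀ {k} {x y : Fin k → ℤ₈} → x ≗ y → Π x ≡ Π y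
Π-cong x≗y = prodF-cong (cong toℕ ∘ x≗y)

Π-permute : ∀ {k} (π : Permutation′ k) (x : Fin k → ℤ₈) → Π (x ∘ (π ⟨$⟩ʳ_)) ≡ Π x
Π-permute π x = prodF-permute (λ i → toℕ (x i)) π

Π₈-cons : ∀ {k} (x : Fin (suc k) → ℤ₈) → Π₈ x ≡ x zero ⊗ Π₈ (tail x)
Π₈-cons x = trans ([m*n]₈≡[m]₈⊗[n]₈ (toℕ (x zero)) (Π (tail x))) (cong (_⊗ Π₈ (tail x)) ([toℕ]₈ (x zero)))

2Π 4Π : ∀ {k} → Op k
2Π x = [ 2 * Π x ]₈
4Π x = [ 4 * Π x ]₈

2Π[x+1] 2Π[x²+1] : ∀ {k} → Fin k → Op k
2Π[x+1]  i x = [ 2 * Π x * (toℕ (x i) + 1) ]₈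
2Π[x²+1] i x = [ 2 * Π x * (toℕ (x i) * toℕ (x i) + 1) ]₈

4Π-ℤ₈ : ∀ {k} (x : Fin (suc k) → ℤ₈) → 4Π x ≡ [ 4 ]₈ ⊗ (x zero ⊗ Π₈ (tail x))
4Π-ℤ₈ x = trans ([m*n]₈≡[m]₈⊗[n]₈ 4 (Π x)) (cong ([ 4 ]₈ ⊗_) (Π₈-cons x))

[2Π*n]₈ : ∀ {k} (x : Fin (suc k) → ℤ₈) n → [ 2 * Π x * n ]₈ ≡ [ 2 ]₈ ⊗ (x zero ⊗ Π₈ (tail x)) ⊗ [ n ]₈
[2Π*n]₈ x n = begin
  [ 2 * Π x * n ]₈              ≡⟨ [m*n]₈≡[m]₈⊗[n]₈ (2 * Π x) n ⟩
  [ 2 * Π x ]₈ ⊗ [ n ]₈         ≡⟨ cong (_⊗ [ n ]₈) ([m*n]₈≡[m]₈⊗[n]₈ 2 (Π x)) ⟩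
  [ 2 ]₈ ⊗ Π₈ x ⊗ [ n ]₈        ≡⟨ cong (λ p → [ 2 ]₈ ⊗ p ⊗ [ n ]₈) (Π₈-cons x) ⟩
  [ 2 ]₈ ⊗ (x zero ⊗ Π₈ (tail x)) ⊗ [ n ]₈ ∎

2Π[x+1]-ℤ₈ : ∀ {k} (x : Fin (suc k) → ℤ₈) →
             2Π[x+1] zero x ≡ [ 2 ]₈ ⊗ (x zero ⊗ Π₈ (tail x)) ⊗ (x zero ⊕ [ 1 ]₈)
2Π[x+1]-ℤ₈ x = [2Π*n]₈ x (toℕ (x zero) + 1)

2Π[x²+1]-ℤ₈ : ∀ {k} (x : Fin (suc k) → ℤ₈) →
              2Π[x²+1] zero x ≡ [ 2 ]₈ ⊗ (x zero ⊗ Π₈ (tail x)) ⊗ (x zero ⊗ x zero ⊕ [ 1 ]₈)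
2Π[x²+1]-ℤ₈ x = trans ([2Π*n]₈ x (y * y + 1)) (cong ([ 2 ]₈ ⊗ (x zero ⊗ Π₈ (tail x)) ⊗_) ([m+n]₈≡[m]₈⊕[n]₈ (y * y) 1))
  where
  y : ℕ
  y = toℕ (x zero)

2up[u²+βu+r] : ℤ₈ → ℤ₈ → Fin 2 → ℤ₈ → ℤ₈
2up[u²+βu+r] u p β r = [ 2 * toℕ u * toℕ p * (toℕ u * toℕ u + toℕ β * toℕ u + toℕ r) ]₈

2up[u²+βu+r]-unreduced : ∀ y P β r →
  [ 2 * (toℕ y * P) * (toℕ y * toℕ y + toℕ β * toℕ y + r) ]₈ ≡ 2up[u²+βu+r] y [ P ]₈ β [ r ]₈
2up[u²+βu+r]-unreduced y P β r = begin
  [ 2 * (u * P) * (Q + r) ]₈                                ≡⟨ cong (λ v → [ v * (Q + r) ]₈) (*-assoc 2 u P) ⟨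
  [ 2 * u * P * (Q + r) ]₈                                  ≡⟨ expand P r ⟩
  [ 2 * u ]₈ ⊗ [ P ]₈ ⊗ ([ Q ]₈ ⊕ [ r ]₈)                   ≡⟨ cong₂ (λ p s → [ 2 * u ]₈ ⊗ p ⊗ ([ Q ]₈ ⊕ s)) ([toℕ]₈ [ P ]₈) ([toℕ]₈ [ r ]₈) ⟨
  [ 2 * u ]₈ ⊗ [ toℕ [ P ]₈ ]₈ ⊗ ([ Q ]₈ ⊕ [ toℕ [ r ]₈ ]₈) ≡⟨ expand (toℕ [ P ]₈) (toℕ [ r ]₈) ⟨
  2up[u²+βu+r] y [ P ]₈ β [ r ]₈                            ∎
  where
  u : ℕ
  u = toℕ y
  Q : ℕ
  Q = u * u + toℕ β * u
  expand : ∀ P r → [ 2 * u * P * (Q + r) ]₈ ≡ [ 2 * u ]₈ ⊗ [ P ]₈ ⊗ ([ Q ]₈ ⊕ [ r ]₈)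
  expand P r = trans ([m*n]₈≡[m]₈⊗[n]₈ (2 * u * P) (Q + r))
                     (cong₂ _⊗_ ([m*n]₈≡[m]₈⊗[n]₈ (2 * u) P) ([m+n]₈≡[m]₈⊕[n]₈ Q r))

record Shaped {m} (β : Fin 2) (R : Op m) (G : Op (suc m)) : Set where
  field
    shape : ∀ x → G x ≡ 2up[u²+βu+r] (x zero) (Π₈ (tail x)) β (R (tail x))

Δ : (ℤ₈ → ℤ₈) → ℤ₈ → ℤ₈ → ℤ₈
Δ φ y z = φ (y ⊕ z) ⊝ φ y ⊝ φ z

Δ-cong : ∀ {φ ψ} → φ ≗ ψ → ∀ y z → Δ φ y z ≡ Δ ψ y z
Δ-cong φ≗ψ y z = cong₂ _⊝_ (cong₂ _⊝_ (φ≗ψ (y ⊕ z)) (φ≗ψ y)) (φ≗ψ z)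

-- For φ u = 2up(u² + βu + r), Δ φ y z = 6pyz(y + z) + 4βpyz. Reading this modulo 8, where 4v² = 4v,
-- gives the three identities below.
Δ-by-2 : ∀ y p β r → Δ (λ u → 2up[u²+βu+r] u p β r) y [ 2 ]₈ ≡ [ 4 ]₈ ⊗ (y ⊗ p)
Δ-by-2 = toWitness {a? = all? λ y → all? λ p → all? λ β → all? λ r → _ ≟ _} _

Δ-by-1 : ∀ y p β r →
  3 · Δ (λ u → 2up[u²+βu+r] u p β r) y [ 1 ]₈ ⊕ toℕ β · ([ 4 ]₈ ⊗ (y ⊗ p)) ≡ [ 2 ]₈ ⊗ (y ⊗ p) ⊗ (y ⊕ [ 1 ]₈)
Δ-by-1 = toWitness {a? = all? λ y → all? λ p → all? λ β → all? λ r → _ ≟ _} _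

Δ-mixed : ∀ y z q β r →
  3 · Δ (λ u → 2up[u²+βu+r] u (z ⊗ q) β r) y z ⊕ toℕ β · ([ 4 ]₈ ⊗ (y ⊗ (z ⊗ q)))
    ≡ [ 2 ]₈ ⊗ (y ⊗ (z ⊗ q)) ⊗ (y ⊗ z ⊕ z ⊗ z)
Δ-mixed = toWitness {a? = all? λ y → all? λ z → all? λ q → all? λ β → all? λ r → _ ≟ _} _

module Shaped-∈C {n m} {g : Op n} (g-ext : Extensional g) {G : Op (suc m)} (G∈g : G ∈C g)
                 {β : Fin 2} {R : Op m} (G-shaped : Shaped β R G) where
  open Shaped G-shaped

  G-at : ∀ {h : Op (suc m)} → h ∈C g → (λ x → G (h x ∷ tail x)) ∈C g
  G-at {h} h∈g = ∈C-app g-ext G∈g arguments∈g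
    where
    arguments∈g : ∀ j → (λ x → (h x ∷ tail x) j) ∈C g
    arguments∈g zero    = h∈g
    arguments∈g (suc j) = ∈C-var (suc j)

  Δ∈C : ∀ {h₁ h₂ : Op (suc m)} → h₁ ∈C g → h₂ ∈C g →
        (λ x → Δ (λ u → G (u ∷ tail x)) (h₁ x) (h₂ x)) ∈C g
  Δ∈C h₁∈g h₂∈g = ∈C-⊝ (∈C-⊝ (G-at (∈C-⊕ h₁∈g h₂∈g)) (G-at h₁∈g)) (G-at h₂∈g)

  Δ-shaped : ∀ x y z →
             Δ (λ u → G (u ∷ tail x)) y z ≡ Δ (λ u → 2up[u²+βu+r] u (Π₈ (tail x)) β (R (tail x))) y z
  Δ-shaped x = Δ-cong (λ u → shape (u ∷ tail x))

  4Π∈C : 4Π ∈C g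
  4Π∈C = ∈C-resp value (Δ∈C (∈C-var zero) (∈C-const [ 2 ]₈))
    where
    value : ∀ x → Δ (λ u → G (u ∷ tail x)) (x zero) [ 2 ]₈ ≡ 4Π x
    value x = trans (Δ-shaped x (x zero) [ 2 ]₈) (trans (Δ-by-2 (x zero) (Π₈ (tail x)) β (R (tail x))) (sym (4Π-ℤ₈ x)))

  2Π[x₀+1]∈C : 2Π[x+1] zero ∈C g
  2Π[x₀+1]∈C = ∈C-resp value (∈C-⊕ (∈C-· 3 (Δ∈C (∈C-var zero) (∈C-const [ 1 ]₈))) (∈C-· (toℕ β) 4Π∈C))
    where
    value : ∀ x → 3 · Δ (λ u → G (u ∷ tail x)) (x zero) [ 1 ]₈ ⊕ toℕ β · 4Π x ≡ 2Π[x+1] zero x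
    value x = begin
      3 · Δ (λ u → G (u ∷ tail x)) (x zero) [ 1 ]₈ ⊕ toℕ β · 4Π x
        ≡⟨ cong₂ (λ d e → 3 · d ⊕ toℕ β · e) (Δ-shaped x (x zero) [ 1 ]₈) (4Π-ℤ₈ x) ⟩
      3 · Δ (λ u → 2up[u²+βu+r] u p β r) (x zero) [ 1 ]₈ ⊕ toℕ β · ([ 4 ]₈ ⊗ (x zero ⊗ p))
        ≡⟨ Δ-by-1 (x zero) p β r ⟩
      [ 2 ]₈ ⊗ (x zero ⊗ p) ⊗ (x zero ⊕ [ 1 ]₈)
        ≡⟨ 2Π[x+1]-ℤ₈ x ⟨
      2Π[x+1] zero x ∎
      where
      p : ℤ₈
      p = Π₈ (tail x)
      r : ℤ₈
      r = R (tail x)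

-- For a unary generator r is a constant, so its contribution 2x₀r is cancelled by a multiple of x₀ + x₀.
2Π[x₀²+1]-from-unary : ∀ y β r →
  2up[u²+βu+r] y [ 1 ]₈ β r ⊝ toℕ β · ([ 2 ]₈ ⊗ (y ⊗ [ 1 ]₈) ⊗ (y ⊕ [ 1 ]₈))
    ⊕ (1 + toℕ β) · (y ⊕ y) ⊝ toℕ r · (y ⊕ y)
    ≡ [ 2 ]₈ ⊗ (y ⊗ [ 1 ]₈) ⊗ (y ⊗ y ⊕ [ 1 ]₈)
2Π[x₀²+1]-from-unary = toWitness {a? = all? λ y → all? λ β → all? λ r → _ ≟ _} _

module Shaped-∈C-unary {n} {g : Op n} (g-ext : Extensional g) {G : Op 1} (G∈g : G ∈C g)
                       {β : Fin 2} {R : Op 0} (R-ext : Extensional R) (G-shaped : Shaped β R G) where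
  open Shaped G-shaped
  open Shaped-∈C g-ext G∈g G-shaped

  r : ℤ₈
  r = R (λ ())

  2Π[x₀²+1]∈C : 2Π[x²+1] zero ∈C g
  2Π[x₀²+1]∈C = ∈C-resp value
    (∈C-⊝ (∈C-⊕ (∈C-⊝ G∈g (∈C-· (toℕ β) 2Π[x₀+1]∈C)) (∈C-· (1 + toℕ β) 2x₀∈C)) (∈C-· (toℕ r) 2x₀∈C))
    where
    2x₀∈C : (λ x → x zero ⊕ x zero) ∈C g
    2x₀∈C = ∈C-⊕ (∈C-var zero) (∈C-var zero)
    value : ∀ x → G x ⊝ toℕ β · 2Π[x+1] zero x ⊕ (1 + toℕ β) · (x zero ⊕ x zero) ⊝ toℕ r · (x zero ⊕ x zero)
                  ≡ 2Π[x²+1] zero x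
    value x = begin
      G x ⊝ toℕ β · 2Π[x+1] zero x ⊕ (1 + toℕ β) · (y ⊕ y) ⊝ toℕ r · (y ⊕ y)
        ≡⟨ cong₂ (λ v w → v ⊝ toℕ β · w ⊕ (1 + toℕ β) · (y ⊕ y) ⊝ toℕ r · (y ⊕ y))
                 (trans (shape x) (cong (2up[u²+βu+r] y [ 1 ]₈ β) (R-ext (λ ())))) (2Π[x+1]-ℤ₈ x) ⟩
      2up[u²+βu+r] y [ 1 ]₈ β r ⊝ toℕ β · ([ 2 ]₈ ⊗ (y ⊗ [ 1 ]₈) ⊗ (y ⊕ [ 1 ]₈))
        ⊕ (1 + toℕ β) · (y ⊕ y) ⊝ toℕ r · (y ⊕ y)
        ≡⟨ 2Π[x₀²+1]-from-unary y β r ⟩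
      [ 2 ]₈ ⊗ (y ⊗ [ 1 ]₈) ⊗ (y ⊗ y ⊕ [ 1 ]₈)
        ≡⟨ 2Π[x²+1]-ℤ₈ x ⟨
      2Π[x²+1] zero x ∎
      where
      y : ℤ₈
      y = x zero

-- The left side is 2Π(y² + 1) + 2Π(y + 1)(z + 1) with Π = yzq, and the second term vanishes modulo 8
-- because y(y + 1) and z(z + 1) are even.
2Π[x₀²+1]-from-binary : ∀ y z q →
  [ 2 ]₈ ⊗ (y ⊗ (z ⊗ q)) ⊗ (y ⊕ [ 1 ]₈) ⊕ [ 2 ]₈ ⊗ (z ⊗ (y ⊗ q)) ⊗ (z ⊕ [ 1 ]₈)
    ⊕ [ 2 ]₈ ⊗ (z ⊗ (y ⊗ q)) ⊗ (z ⊗ y ⊕ y ⊗ y)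
    ≡ [ 2 ]₈ ⊗ (y ⊗ (z ⊗ q)) ⊗ (y ⊗ y ⊕ [ 1 ]₈)
2Π[x₀²+1]-from-binary = toWitness {a? = all? λ y → all? λ z → all? λ q → _ ≟ _} _

module Shaped-∈C-binary {n m} {g : Op n} (g-ext : Extensional g) {G : Op (suc (suc m))} (G∈g : G ∈C g)
                        {β : Fin 2} {R : Op (suc m)} (G-shaped : Shaped β R G) where
  open Shaped-∈C g-ext G∈g G-shaped

  2Π[x₀x₁+x₁²] : Op (suc (suc m))
  2Π[x₀x₁+x₁²] x = [ 2 ]₈ ⊗ (x zero ⊗ (x (suc zero) ⊗ Π₈ (tail (tail x))))
                         ⊗ (x zero ⊗ x (suc zero) ⊕ x (suc zero) ⊗ x (suc zero))

  2Π[x₀x₁+x₁²]∈C : 2Π[x₀x₁+x₁²] ∈C g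
  2Π[x₀x₁+x₁²]∈C = ∈C-resp value (∈C-⊕ (∈C-· 3 (Δ∈C (∈C-var zero) (∈C-var (suc zero)))) (∈C-· (toℕ β) 4Π∈C))
    where
    value : ∀ x → 3 · Δ (λ u → G (u ∷ tail x)) (x zero) (x (suc zero)) ⊕ toℕ β · 4Π x ≡ 2Π[x₀x₁+x₁²] x
    value x = begin
      3 · Δ (λ u → G (u ∷ tail x)) y z ⊕ toℕ β · 4Π x
        ≡⟨ cong₂ (λ d e → 3 · d ⊕ toℕ β · e) (Δ-shaped x y z) (4Π-ℤ₈ x) ⟩
      3 · Δ (λ u → 2up[u²+βu+r] u (Π₈ (tail x)) β r) y z ⊕ toℕ β · ([ 4 ]₈ ⊗ (y ⊗ Π₈ (tail x)))
        ≡⟨ cong (λ p → 3 · Δ (λ u → 2up[u²+βu+r] u p β r) y z ⊕ toℕ β · ([ 4 ]₈ ⊗ (y ⊗ p))) (Π₈-cons (tail x)) ⟩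
      3 · Δ (λ u → 2up[u²+βu+r] u (z ⊗ q) β r) y z ⊕ toℕ β · ([ 4 ]₈ ⊗ (y ⊗ (z ⊗ q)))
        ≡⟨ Δ-mixed y z q β r ⟩
      2Π[x₀x₁+x₁²] x ∎
      where
      y : ℤ₈
      y = x zero
      z : ℤ₈
      z = x (suc zero)
      q : ℤ₈
      q = Π₈ (tail (tail x))
      r : ℤ₈
      r = R (tail x)

  2Π[x₀²+1]∈C : 2Π[x²+1] zero ∈C g
  2Π[x₀²+1]∈C = ∈C-resp value
    (∈C-⊕ (∈C-⊕ 2Π[x₀+1]∈C (∈C-rename g-ext swap 2Π[x₀+1]∈C)) (∈C-rename g-ext swap 2Π[x₀x₁+x₁²]∈C))
    where
    swap : Fin (suc (suc m)) → Fin (suc (suc m))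
    swap = transpose zero (suc zero) ⟨$⟩ʳ_
    value : ∀ x → 2Π[x+1] zero x ⊕ 2Π[x+1] zero (x ∘ swap) ⊕ 2Π[x₀x₁+x₁²] (x ∘ swap) ≡ 2Π[x²+1] zero x
    value x = begin
      2Π[x+1] zero x ⊕ 2Π[x+1] zero (x ∘ swap) ⊕ 2Π[x₀x₁+x₁²] (x ∘ swap)
        ≡⟨ cong₂ (λ v w → v ⊕ w ⊕ 2Π[x₀x₁+x₁²] (x ∘ swap))
                 (trans (2Π[x+1]-ℤ₈ x) (cong (λ p → [ 2 ]₈ ⊗ (y ⊗ p) ⊗ (y ⊕ [ 1 ]₈)) (Π₈-cons (tail x))))
                 (trans (2Π[x+1]-ℤ₈ (x ∘ swap)) (cong (λ p → [ 2 ]₈ ⊗ (z ⊗ p) ⊗ (z ⊕ [ 1 ]₈)) (Π₈-cons (tail (x ∘ swap))))) ⟩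
      [ 2 ]₈ ⊗ (y ⊗ (z ⊗ q)) ⊗ (y ⊕ [ 1 ]₈) ⊕ [ 2 ]₈ ⊗ (z ⊗ (y ⊗ q)) ⊗ (z ⊕ [ 1 ]₈)
        ⊕ [ 2 ]₈ ⊗ (z ⊗ (y ⊗ q)) ⊗ (z ⊗ y ⊕ y ⊗ y)
        ≡⟨ 2Π[x₀²+1]-from-binary y z q ⟩
      [ 2 ]₈ ⊗ (y ⊗ (z ⊗ q)) ⊗ (y ⊗ y ⊕ [ 1 ]₈)
        ≡⟨ trans (2Π[x²+1]-ℤ₈ x) (cong (λ p → [ 2 ]₈ ⊗ (y ⊗ p) ⊗ (y ⊗ y ⊕ [ 1 ]₈)) (Π₈-cons (tail x))) ⟨
      2Π[x²+1] zero x ∎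
      where
      y : ℤ₈
      y = x zero
      z : ℤ₈
      z = x (suc zero)
      q : ℤ₈
      q = Π₈ (tail (tail x))

shaped⇒2Π[x₀²+1]∈C : ∀ {n m} {g : Op n} → Extensional g → ∀ {G : Op (suc m)} → G ∈C g →
                     ∀ {β} {R : Op m} → Extensional R → Shaped β R G → 2Π[x²+1] {suc m} zero ∈C g
shaped⇒2Π[x₀²+1]∈C {m = zero}  g-ext G∈g R-ext G-shaped = Shaped-∈C-unary.2Π[x₀²+1]∈C g-ext G∈g R-ext G-shaped
shaped⇒2Π[x₀²+1]∈C {m = suc m} g-ext G∈g R-ext G-shaped = Shaped-∈C-binary.2Π[x₀²+1]∈C g-ext G∈g G-shaped

∈C-any-variable : ∀ {n k} {g : Op n} → Extensional g → (φ : ℕ → ℕ → ℕ) →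
                  (λ x → [ φ (Π x) (toℕ (x zero)) ]₈) ∈C g →
                  (i : Fin (suc k)) → (λ x → [ φ (Π x) (toℕ (x i)) ]₈) ∈C g
∈C-any-variable {k = k} g-ext φ h∈g i =
  ∈C-resp (λ x → cong (λ P → [ φ P (toℕ (x i)) ]₈) (Π-permute π x)) (∈C-rename g-ext (π ⟨$⟩ʳ_) h∈g)
  where
  π : Permutation′ (suc k)
  π = transpose zero i

record Atoms {n} (g : Op n) (k : ℕ) : Set where
  field
    2Π[x²+1]∈C : (i : Fin k) → 2Π[x²+1] i ∈C g
    2Π[x+1]∈C  : (i : Fin k) → 2Π[x+1] i ∈C g
    4Π∈C       : 4Π {k} ∈C g

shaped⇒atoms : ∀ {n m} {g : Op n} → Extensional g → ∀ {G : Op (suc m)} → G ∈C g →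
               ∀ {β} {R : Op m} → Extensional R → Shaped β R G → Atoms g (suc m)
shaped⇒atoms g-ext G∈g R-ext G-shaped = record
  { 2Π[x²+1]∈C = ∈C-any-variable g-ext (λ P y → 2 * P * (y * y + 1)) (shaped⇒2Π[x₀²+1]∈C g-ext G∈g R-ext G-shaped)
  ; 2Π[x+1]∈C  = ∈C-any-variable g-ext (λ P y → 2 * P * (y + 1)) 2Π[x₀+1]∈C
  ; 4Π∈C       = 4Π∈C
  }
  where
  open Shaped-∈C g-ext G∈g G-shaped

Σax² : ∀ {k} → (Fin k → Fin 2) → (Fin k → ℤ₈) → ℕ
Σax² a x = sumF (λ i → toℕ (a i) * toℕ (x i) * toℕ (x i))

Σbx : ∀ {k} → (Fin k → Fin 2) → (Fin k → ℤ₈) → ℕ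
Σbx b x = sumF (λ i → toℕ (b i) * toℕ (x i))

Σax²-cong : ∀ {k} (a : Fin k → Fin 2) {x y} → x ≗ y → Σax² a x ≡ Σax² a y
Σax²-cong a x≗y = sumF-cong (λ i → cong (λ u → toℕ (a i) * u * u) (cong toℕ (x≗y i)))

Σbx-cong : ∀ {k} (b : Fin k → Fin 2) {x y} → x ≗ y → Σbx b x ≡ Σbx b y
Σbx-cong b x≗y = sumF-cong (λ i → cong (λ u → toℕ (b i) * u) (cong toℕ (x≗y i)))

fOp-ext : ∀ {k} (a b : Fin k → Fin 2) c → Extensional (fOp a b c)
fOp-ext a b c x≗y = cong₂ (λ P S → [ 2 * P * (S + toℕ c) ]₈) (Π-cong x≗y) (cong₂ _+_ (Σax²-cong a x≗y) (Σbx-cong b x≗y))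

2Π[x²+1]-ext : ∀ {k} (i : Fin k) → Extensional (2Π[x²+1] i)
2Π[x²+1]-ext i x≗y = cong₂ (λ P u → [ 2 * P * (u * u + 1) ]₈) (Π-cong x≗y) (cong toℕ (x≗y i))

twoQ-ext : ∀ m → Extensional (twoQ m)
twoQ-ext m x≗y = cong₂ (λ P u → [ 2 * u * u * P ]₈) (Π-cong x≗y) (cong toℕ (x≗y zero))

fOp-permute : ∀ {k} (a b : Fin k → Fin 2) c (π : Permutation′ k) x →
              fOp (a ∘ (π ⟨$⟩ʳ_)) (b ∘ (π ⟨$⟩ʳ_)) c (x ∘ (π ⟨$⟩ʳ_)) ≡ fOp a b c x
fOp-permute a b c π x = cong₂ (λ P S → [ 2 * P * (S + toℕ c) ]₈) (Π-permute π x)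
  (cong₂ _+_ (sumF-permute (λ i → toℕ (a i) * toℕ (x i) * toℕ (x i)) π) (sumF-permute (λ i → toℕ (b i) * toℕ (x i)) π))

fOp-rest : ∀ {m} → (Fin (suc m) → Fin 2) → (Fin (suc m) → Fin 2) → Fin 4 → Op m
fOp-rest a b c t = [ Σax² (tail a) t + Σbx (tail b) t + toℕ c ]₈

fOp-rest-ext : ∀ {m} (a b : Fin (suc m) → Fin 2) c → Extensional (fOp-rest a b c)
fOp-rest-ext a b c x≗y = cong₂ (λ S T → [ S + T + toℕ c ]₈) (Σax²-cong (tail a) x≗y) (Σbx-cong (tail b) x≗y)

fOp-shaped : ∀ {m} (a b : Fin (suc m) → Fin 2) c → a zero ≡ suc zero → Shaped (b zero) (fOp-rest a b c) (fOp a b c)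
Shaped.shape (fOp-shaped a b c a₀≡1) x = begin
  fOp a b c x
    ≡⟨ cong (λ α → [ 2 * (u * P) * ((α * u * u + SA) + (β * u + SB) + toℕ c) ]₈) (cong toℕ a₀≡1) ⟩
  [ 2 * (u * P) * ((1 * u * u + SA) + (β * u + SB) + toℕ c) ]₈
    ≡⟨ cong [_]₈ (regroup u P β SA SB (toℕ c)) ⟩
  [ 2 * (u * P) * (u * u + β * u + (SA + SB + toℕ c)) ]₈
    ≡⟨ 2up[u²+βu+r]-unreduced (x zero) P (b zero) (SA + SB + toℕ c) ⟩
  2up[u²+βu+r] (x zero) (Π₈ (tail x)) (b zero) (fOp-rest a b c (tail x)) ∎
  where
  u : ℕ
  u = toℕ (x zero)
  P : ℕ
  P = Π (tail x)
  β : ℕ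
  β = toℕ (b zero)
  SA : ℕ
  SA = Σax² (tail a) (tail x)
  SB : ℕ
  SB = Σbx (tail b) (tail x)
  regroup : ∀ u P β SA SB c →
            2 * (u * P) * ((1 * u * u + SA) + (β * u + SB) + c) ≡ 2 * (u * P) * (u * u + β * u + (SA + SB + c))
  regroup = solve-∀

twoW-shaped : ∀ m → Shaped zero (λ _ → [ 1 ]₈) (twoW m)
Shaped.shape (twoW-shaped m) x =
  trans (cong (λ s → [ 2 * Π x * (s + 1) ]₈) (sym (+-identityʳ (u * u))))
        (2up[u²+βu+r]-unreduced (x zero) (Π (tail x)) zero 1)
  where
  u : ℕ
  u = toℕ (x zero)

twoQ-shaped : ∀ m → Shaped zero (λ _ → [ 0 ]₈) (twoQ m)
Shaped.shape (twoQ-shaped m) x =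
  trans (cong [_]₈ (regroup (toℕ (x zero)) (Π (tail x))))
        (2up[u²+βu+r]-unreduced (x zero) (Π (tail x)) zero 0)
  where
  regroup : ∀ u P → 2 * u * u * (u * P) ≡ 2 * (u * P) * (u * u + 0 + 0)
  regroup = solve-∀

fOp-atoms : ∀ {m} (a b : Fin (suc m) → Fin 2) c k → a k ≡ suc zero → Atoms (fOp a b c) (suc m)
fOp-atoms {m} a b c k aₖ≡1 =
  shaped⇒atoms (fOp-ext a b c) moved∈f (fOp-rest-ext (a ∘ ρ) (b ∘ ρ) c) (fOp-shaped (a ∘ ρ) (b ∘ ρ) c aₖ≡1)
  where
  π : Permutation′ (suc m)
  π = transpose zero k
  ρ : Fin (suc m) → Fin (suc m)
  ρ = π ⟨$⟩ʳ_
  moved : ∀ x → fOp a b c (x ∘ (π ⟨$⟩ˡ_)) ≡ fOp (a ∘ ρ) (b ∘ ρ) c x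
  moved x = begin
    fOp a b c (x ∘ (π ⟨$⟩ˡ_))                      ≡⟨ fOp-permute a b c π (x ∘ (π ⟨$⟩ˡ_)) ⟨
    fOp (a ∘ ρ) (b ∘ ρ) c (x ∘ (π ⟨$⟩ˡ_) ∘ ρ)      ≡⟨ fOp-ext (a ∘ ρ) (b ∘ ρ) c (λ i → cong x (inverseˡ π {i})) ⟩
    fOp (a ∘ ρ) (b ∘ ρ) c x                        ∎
  moved∈f : fOp (a ∘ ρ) (b ∘ ρ) c ∈C fOp a b c
  moved∈f = ∈C-resp moved (∈C-rename (fOp-ext a b c) (π ⟨$⟩ˡ_) ∈C-refl)

-- Generating f from the atoms

module _ {k} (a b : Fin k → Fin 2) (c : Fin 4) where

  A B κ : ℕ
  A = sumF (λ i → toℕ (a i))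
  B = sumF (λ i → toℕ (b i))
  κ = toℕ c + 7 * (A + B)

  ΣaV ΣbX Σatoms : (Fin k → ℤ₈) → ℕ
  ΣaV x = sumF (λ i → toℕ (a i) * (2 * Π x * (toℕ (x i) * toℕ (x i) + 1)))
  ΣbX x = sumF (λ i → toℕ (b i) * (2 * Π x * (toℕ (x i) + 1)))
  Σatoms x = ΣaV x + ΣbX x

  Σatoms₈ : Op k
  Σatoms₈ x = Σ₈ (λ i → toℕ (a i) · 2Π[x²+1] i x) ⊕ Σ₈ (λ i → toℕ (b i) · 2Π[x+1] i x)

  Σatoms₈≡[Σatoms]₈ : ∀ x → Σatoms₈ x ≡ [ Σatoms x ]₈
  Σatoms₈≡[Σatoms]₈ x = sym (trans ([m+n]₈≡[m]₈⊕[n]₈ (ΣaV x) (ΣbX x)) (cong₂ _⊕_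
    ([Σk*n]₈≡Σk·[n]₈ (λ i → toℕ (a i)) (λ i → 2 * Π x * (toℕ (x i) * toℕ (x i) + 1)))
    ([Σk*n]₈≡Σk·[n]₈ (λ i → toℕ (b i)) (λ i → 2 * Π x * (toℕ (x i) + 1)))))

  Σatoms-closed-form : ∀ x → Σatoms x ≡ 2 * Π x * (Σax² a x + A) + 2 * Π x * (Σbx b x + B)
  Σatoms-closed-form x = cong₂ _+_
    (trans (sumF-*[+1] (λ i → toℕ (a i)) (λ i → toℕ (x i) * toℕ (x i)) (2 * Π x))
           (cong (λ S → 2 * Π x * (S + A)) (sumF-cong (λ i → sym (*-assoc (toℕ (a i)) (toℕ (x i)) (toℕ (x i)))))))
    (sumF-*[+1] (λ i → toℕ (b i)) (λ i → toℕ (x i)) (2 * Π x))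

  Σatoms₈⊕κ·2Π≡fOp : ∀ x → Σatoms₈ x ⊕ κ · 2Π x ≡ fOp a b c x
  Σatoms₈⊕κ·2Π≡fOp x = begin
    Σatoms₈ x ⊕ κ · 2Π x
      ≡⟨ cong₂ _⊕_ (Σatoms₈≡[Σatoms]₈ x) (sym ([k*n]₈≡k·[n]₈ κ (2 * Π x))) ⟩
    [ Σatoms x ]₈ ⊕ [ κ * (2 * Π x) ]₈
      ≡⟨ [m+n]₈≡[m]₈⊕[n]₈ (Σatoms x) (κ * (2 * Π x)) ⟨
    [ Σatoms x + κ * (2 * Π x) ]₈
      ≡⟨ cong (λ s → [ s + κ * (2 * Π x) ]₈) (Σatoms-closed-form x) ⟩
    [ 2 * Π x * (Σax² a x + A) + 2 * Π x * (Σbx b x + B) + κ * (2 * Π x) ]₈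
      ≡⟨ cong [_]₈ (regroup (Π x) (Σax² a x) (Σbx b x) A B (toℕ c)) ⟩
    [ 2 * Π x * (Σax² a x + Σbx b x + toℕ c) + 8 * (2 * Π x * (A + B)) ]₈
      ≡⟨ [m+8k]₈≡[m]₈ (2 * Π x * (Σax² a x + Σbx b x + toℕ c)) (2 * Π x * (A + B)) ⟩
    fOp a b c x ∎
    where
    regroup : ∀ P SA SB A B c → 2 * P * (SA + A) + 2 * P * (SB + B) + (c + 7 * (A + B)) * (2 * P)
                                ≡ 2 * P * (SA + SB + c) + 8 * (2 * P * (A + B))
    regroup = solve-∀

  fOp⊝Σatoms₈≡κ·2Π : ∀ x → fOp a b c x ⊝ Σatoms₈ x ≡ κ · 2Π x
  fOp⊝Σatoms₈≡κ·2Π x = begin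
    fOp a b c x ⊝ Σatoms₈ x
      ≡⟨ cong (fOp a b c x ⊝_) (Σatoms₈≡[Σatoms]₈ x) ⟩
    [ N ]₈ ⊝ [ Σatoms x ]₈
      ≡⟨ [m]₈⊝[n]₈ N (Σatoms x) ⟩
    [ N + 7 * Σatoms x ]₈
      ≡⟨ cong (λ s → [ N + 7 * s ]₈) (Σatoms-closed-form x) ⟩
    [ N + 7 * (2 * Π x * (Σax² a x + A) + 2 * Π x * (Σbx b x + B)) ]₈
      ≡⟨ cong [_]₈ (regroup (Π x) (Σax² a x) (Σbx b x) A B (toℕ c)) ⟩
    [ κ * (2 * Π x) + 8 * (2 * Π x * (Σax² a x + Σbx b x)) ]₈
      ≡⟨ [m+8k]₈≡[m]₈ (κ * (2 * Π x)) (2 * Π x * (Σax² a x + Σbx b x)) ⟩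
    [ κ * (2 * Π x) ]₈
      ≡⟨ [k*n]₈≡k·[n]₈ κ (2 * Π x) ⟩
    κ · 2Π x ∎
    where
    N : ℕ
    N = 2 * Π x * (Σax² a x + Σbx b x + toℕ c)
    regroup : ∀ P SA SB A B c → 2 * P * (SA + SB + c) + 7 * (2 * P * (SA + A) + 2 * P * (SB + B))
                                ≡ (c + 7 * (A + B)) * (2 * P) + 8 * (2 * P * (SA + SB))
    regroup = solve-∀

  κ-parity : κ ≡ 2 * (3 * (A + B)) + (A + B + toℕ c)
  κ-parity = regroup A B (toℕ c)
    where
    regroup : ∀ A B c → c + 7 * (A + B) ≡ 2 * (3 * (A + B)) + (A + B + c)
    regroup = solve-∀

  InG₀⇒2∣κ : InG₀ a b c → 2 ∣ κ
  InG₀⇒2∣κ 2∣A+B+c = subst (2 ∣_) (sym κ-parity) (∣m∣n⇒∣m+n (m∣m*n (3 * (A + B))) 2∣A+B+c)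

  2∣κ⇒InG₀ : 2 ∣ κ → InG₀ a b c
  2∣κ⇒InG₀ 2∣κ = ∣m+n∣m⇒∣n (subst (2 ∣_) κ-parity 2∣κ) (m∣m*n (3 * (A + B)))

  module _ {n} {g : Op n} (atoms : Atoms g k) where
    open Atoms atoms

    Σatoms₈∈C : Σatoms₈ ∈C g
    Σatoms₈∈C = ∈C-⊕ (∈C-Σ₈ (λ i → ∈C-· (toℕ (a i)) (2Π[x²+1]∈C i)))
                     (∈C-Σ₈ (λ i → ∈C-· (toℕ (b i)) (2Π[x+1]∈C i)))

    κ·2Π∈C⇒fOp∈C : (λ x → κ · 2Π x) ∈C g → fOp a b c ∈C g
    κ·2Π∈C⇒fOp∈C κ·2Π∈g = ∈C-resp Σatoms₈⊕κ·2Π≡fOp (∈C-⊕ Σatoms₈∈C κ·2Π∈g)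

    fOp∈C⇒κ·2Π∈C : fOp a b c ∈C g → (λ x → κ · 2Π x) ∈C g
    fOp∈C⇒κ·2Π∈C f∈g = ∈C-resp fOp⊝Σatoms₈≡κ·2Π (∈C-⊝ f∈g Σatoms₈∈C)

    InG₀⇒fOp∈C : InG₀ a b c → fOp a b c ∈C g
    InG₀⇒fOp∈C f∈G₀ with InG₀⇒2∣κ f∈G₀
    ... | divides h κ≡h*2 = κ·2Π∈C⇒fOp∈C (∈C-resp h·4Π≡κ·2Π (∈C-· h 4Π∈C))
      where
      regroup : ∀ h P → h * (4 * P) ≡ h * 2 * (2 * P)
      regroup = solve-∀
      h·4Π≡κ·2Π : ∀ x → h · 4Π x ≡ κ · 2Π x
      h·4Π≡κ·2Π x = begin
        h · 4Π x             ≡⟨ [k*n]₈≡k·[n]₈ h (4 * Π x) ⟨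
        [ h * (4 * Π x) ]₈   ≡⟨ cong [_]₈ (trans (regroup h (Π x)) (cong (_* (2 * Π x)) (sym κ≡h*2))) ⟩
        [ κ * (2 * Π x) ]₈   ≡⟨ [k*n]₈≡k·[n]₈ κ (2 * Π x) ⟩
        κ · 2Π x             ∎

    2Π∈C⇒fOp∈C : 2Π ∈C g → fOp a b c ∈C g
    2Π∈C⇒fOp∈C 2Π∈g = κ·2Π∈C⇒fOp∈C (∈C-· κ 2Π∈g)

    fOp∈C⇒2Π∈C : ¬ InG₀ a b c → fOp a b c ∈C g → 2Π ∈C g
    fOp∈C⇒2Π∈C f∉G₀ f∈g = ∈C-resp κ·κ·2Π≡2Π (∈C-· κ (fOp∈C⇒κ·2Π∈C f∈g))
      where
      κ·κ·2Π≡2Π : ∀ x → κ · κ · 2Π x ≡ 2Π x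
      κ·κ·2Π≡2Π x = begin
        κ · κ · 2Π x                ≡⟨ cong (κ ·_) ([k*n]₈≡k·[n]₈ κ (2 * Π x)) ⟨
        κ · [ κ * (2 * Π x) ]₈      ≡⟨ [k*n]₈≡k·[n]₈ κ (κ * (2 * Π x)) ⟨
        [ κ * (κ * (2 * Π x)) ]₈    ≡⟨ cong [_]₈ (*-assoc κ κ (2 * Π x)) ⟨
        [ κ * κ * (2 * Π x) ]₈      ≡⟨ [m*n]₈≡[m]₈⊗[n]₈ (κ * κ) (2 * Π x) ⟩
        [ κ * κ ]₈ ⊗ 2Π x           ≡⟨ cong (_⊗ 2Π x) (odd-square (f∉G₀ ∘ 2∣κ⇒InG₀)) ⟩
        [ 1 ]₈ ⊗ 2Π x               ≡⟨ [m*n]₈≡[m]₈⊗[n]₈ 1 (2 * Π x) ⟨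
        [ 1 * (2 * Π x) ]₈          ≡⟨ cong [_]₈ (*-identityˡ (2 * Π x)) ⟩
        2Π x                        ∎

module _ {n m} {g : Op n} (W∈g : 2Π[x²+1] {suc m} zero ∈C g) where

  2Π∈C⇒twoQ∈C : 2Π ∈C g → twoQ m ∈C g
  2Π∈C⇒twoQ∈C 2Π∈g = ∈C-resp W⊝2Π≡Q (∈C-⊝ W∈g 2Π∈g)
    where
    regroup : ∀ y P → 2 * P * (y * y + 1) + 7 * (2 * P) ≡ 2 * y * y * P + 8 * (2 * P)
    regroup = solve-∀
    W⊝2Π≡Q : ∀ x → 2Π[x²+1] zero x ⊝ 2Π x ≡ twoQ m x
    W⊝2Π≡Q x = begin
      2Π[x²+1] zero x ⊝ 2Π x                        ≡⟨ [m]₈⊝[n]₈ (2 * Π x * (y * y + 1)) (2 * Π x) ⟩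
      [ 2 * Π x * (y * y + 1) + 7 * (2 * Π x) ]₈   ≡⟨ cong [_]₈ (regroup y (Π x)) ⟩
      [ 2 * y * y * Π x + 8 * (2 * Π x) ]₈          ≡⟨ [m+8k]₈≡[m]₈ (2 * y * y * Π x) (2 * Π x) ⟩
      twoQ m x                                      ∎
      where
      y : ℕ
      y = toℕ (x zero)

  twoQ∈C⇒2Π∈C : twoQ m ∈C g → 2Π ∈C g
  twoQ∈C⇒2Π∈C Q∈g = ∈C-resp W⊝Q≡2Π (∈C-⊝ W∈g Q∈g)
    where
    regroup : ∀ y P → 2 * P * (y * y + 1) + 7 * (2 * y * y * P) ≡ 2 * P + 8 * (2 * y * y * P)
    regroup = solve-∀
    W⊝Q≡2Π : ∀ x → 2Π[x²+1] zero x ⊝ twoQ m x ≡ 2Π x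
    W⊝Q≡2Π x = begin
      2Π[x²+1] zero x ⊝ twoQ m x                           ≡⟨ [m]₈⊝[n]₈ (2 * Π x * (y * y + 1)) (2 * y * y * Π x) ⟩
      [ 2 * Π x * (y * y + 1) + 7 * (2 * y * y * Π x) ]₈  ≡⟨ cong [_]₈ (regroup y (Π x)) ⟩
      [ 2 * Π x + 8 * (2 * y * y * Π x) ]₈                ≡⟨ [m+8k]₈≡[m]₈ (2 * Π x) (2 * y * y * Π x) ⟩
      2Π x                                                ∎
      where
      y : ℕ
      y = toℕ (x zero)

theorem4p1 : (m : ℕ) (a b : Fin (suc m) → Fin 2) (c : Fin 4) →
    (∃ λ i → a i ≡ suc zero) →
    (InG₀ a b c → fOp a b c ≡C twoW m) ×
    (¬ InG₀ a b c → fOp a b c ≡C twoQ m)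
theorem4p1 m a b c (k , aₖ≡1) = G₀-case , G₁∖G₀-case
  where
  atoms-f : Atoms (fOp a b c) (suc m)
  atoms-f = fOp-atoms a b c k aₖ≡1

  atoms-W : Atoms (twoW m) (suc m)
  atoms-W = shaped⇒atoms (2Π[x²+1]-ext zero) ∈C-refl (λ _ → refl) (twoW-shaped m)

  atoms-Q : Atoms (twoQ m) (suc m)
  atoms-Q = shaped⇒atoms (twoQ-ext m) ∈C-refl (λ _ → refl) (twoQ-shaped m)

  G₀-case : InG₀ a b c → fOp a b c ≡C twoW m
  G₀-case f∈G₀ = mutually-∈C⇒≡C (fOp-ext a b c) (2Π[x²+1]-ext zero)
    (InG₀⇒fOp∈C a b c atoms-W f∈G₀)
    (Atoms.2Π[x²+1]∈C atoms-f zero)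

  G₁∖G₀-case : ¬ InG₀ a b c → fOp a b c ≡C twoQ m
  G₁∖G₀-case f∉G₀ = mutually-∈C⇒≡C (fOp-ext a b c) (twoQ-ext m)
    (2Π∈C⇒fOp∈C a b c atoms-Q (twoQ∈C⇒2Π∈C (Atoms.2Π[x²+1]∈C atoms-Q zero) ∈C-refl))
    (2Π∈C⇒twoQ∈C (Atoms.2Π[x²+1]∈C atoms-f zero) (fOp∈C⇒2Π∈C a b c atoms-f f∉G₀ ∈C-refl))
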